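{- Let $T$ be a (finite) tree. For every finite simple undirected graph $G$, $\chi_o^+(G\,\square\,T)\le 6\,\chi_o^+(G)$.
   Context: An oriented graph is a digraph with no loops, no multiple arcs and no pair of opposite arcs; an orientation of an undirected graph gives each edge one of its two directions. A homomorphism between oriented graphs is a vertex map sending arcs to arcs. The upper oriented chromatic number $\chi_o^+(G)$ is the smallest order of an oriented graph $\vec T$ such that every orientation of $G$ admits a homomorphism to $\vec T$. The Cartesian product $G\,\square\,H$ has vertex set $V(G)\times V(H)$, and $\{[u,v],[u',v']\}$ is an edge iff either $u=u'$ and $\{v,v'\}\in E(H)$, or $v=v'$ and $\{u,u'\}\in E(G)$. -}

module Defs where

open import Data.Nat using (ℕ; suc; _+_)
open import Data.Fin using (Fin; zero; suc; fromℕ; inject₁)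
open import Data.Bool using (Bool; true; false; _∧_; _∨_)
open import Data.Product using (Σ; _×_; _,_; ∃-syntax)
open import Data.Sum using (_⊎_)
open import Data.Empty using (⊥)
open import Data.List using (List; []; _∷_)
open import Data.Fin using (_≟_)
open import Relation.Nullary.Decidable using (⌊_⌋)
open import Relation.Nullary using (¬_)
open import Relation.Binary.PropositionalEquality using (_≡_)
open import Function.Definitions using (Injective)

record Graph (n : ℕ) : Set where
  field
    adj   : Fin n → Fin n → Bool
    sym   : ∀ u v → adj u v ≡ true → adj v u ≡ true
    loopless : ∀ u → adj u u ≡ false
open Graph public

□-adj : ∀ {m n} → Graph m → Graph n → (Fin m × Fin n) → (Fin m × Fin n) → Bool
□-adj G H (u , v) (u' , v') =
  (⌊ u ≟ u' ⌋ ∧ adj H v v') ∨ (⌊ v ≟ v' ⌋ ∧ adj G u u')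

-- An oriented graph on a vertex type V: Bool-valued arc relation with no loops
-- and no pair of opposite arcs (multiple arcs are impossible by construction).
record IsOriented {V : Set} (arc : V → V → Bool) : Set where
  field
    noLoop : ∀ x → arc x x ≡ false
    noOpp  : ∀ x y → arc x y ≡ true → arc y x ≡ false
open IsOriented public

record IsOrientation {V : Set} (a : V → V → Bool) (arc : V → V → Bool) : Set where
  field
    oriented : IsOriented arc
    arc⇒edge : ∀ x y → arc x y ≡ true → a x y ≡ true
    edge⇒arc : ∀ x y → a x y ≡ true → (arc x y ≡ true) ⊎ (arc y x ≡ true)
open IsOrientation public

record OrientedGraph (k : ℕ) : Set where
  field
    arcT   : Fin k → Fin k → Bool
    isOrT  : IsOriented arcT
open OrientedGraph public

IsHom : ∀ {V W : Set} → (V → V → Bool) → (W → W → Bool) → (V → W) → Set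
IsHom arc₁ arc₂ f = ∀ x y → arc₁ x y ≡ true → arc₂ (f x) (f y) ≡ true

-- "χ_o^+ ≤ k" for the undirected graph with adjacency `a` on V:
-- there is an oriented graph of order k to which every orientation maps.
UpperOColorable : {V : Set} → (V → V → Bool) → ℕ → Set
UpperOColorable {V} a k =
  Σ (OrientedGraph k) λ T →
    ∀ (arc : V → V → Bool) → IsOrientation a arc →
      Σ (V → Fin k) λ f → IsHom arc (arcT T) f

data Walk {n : ℕ} (G : Graph n) : Fin n → Fin n → Set where
  here : ∀ {u} → Walk G u u
  step : ∀ {u v w} → adj G u v ≡ true → Walk G v w → Walk G u w

Connected : ∀ {n} → Graph n → Set
Connected {n} G = ∀ (u v : Fin n) → Walk G u v

record Cycle {n : ℕ} (G : Graph n) : Set where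
  field
    len  : ℕ
    c    : Fin (suc (suc (suc len))) → Fin n
    inj  : Injective _≡_ _≡_ c
    cons : ∀ (i : Fin (suc (suc len))) → adj G (c (inject₁ i)) (c (suc i)) ≡ true
    close : adj G (c (fromℕ (suc (suc len)))) (c zero) ≡ true

Acyclic : ∀ {n} → Graph n → Set
Acyclic G = ¬ Cycle G

IsTree : ∀ {n} → Graph n → Set
IsTree G = Connected G × Acyclic G

-- Root the tree T and give the vertex (u , v) of G □ T three pieces of data: the depth
-- of v modulo 3, whether the tree edge from (u , v) to (u , parent v) is oriented
-- towards the parent, and the colour of u under a homomorphism of the copy G × {v} into
-- an oriented graph Tₖ of order k. In the target, vertices of equal depth class are
-- joined as in Tₖ, and between consecutive depth classes the arc points the way the
-- deeper vertex's bit says. Since T is acyclic, every edge of T joins a vertex to its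
-- parent, so the depth classes of its ends are consecutive and the orientation of the
-- edge is recorded by the deeper end.
module Submission where

open import Defs hiding (sym)
open import Data.Bool using (Bool; true; false; not; _∧_; _∨_)
open import Data.Bool.Properties using (∧-zeroʳ; ∨-identityʳ)
open import Data.Empty using (⊥; ⊥-elim)
open import Data.Fin using (Fin; zero; suc; fromℕ; inject₁; opposite; _≟_)
open import Data.Fin.Properties using (*↔×; 2↔Bool; opposite-involutive)
open import Data.List using (List; []; _∷_; allFin)
open import Data.List.Membership.Propositional.Properties using (∈-allFin)
open import Data.List.Relation.Unary.All using (All; []; _∷_; lookup)
open import Data.Nat using (ℕ; zero; suc; _+_; _*_; _≤_; _<_; s≤s⁻¹; _≤?_)
open import Data.Nat.Properties
  using (≤-refl; ≤-trans; n≮0; ≤-reflexive; <⇒≤; <-≤-trans; <-irrefl; ≰⇒≥; n≤0⇒n≡0; m+n≤o⇒m≤o; +-comm)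
open import Data.Product using (Σ; _×_; _,_; proj₁; proj₂; map₂)
open import Data.Product.Function.NonDependent.Propositional using (_×-↔_)
open import Data.Sum using (_⊎_; inj₁; inj₂)
import Data.Sum as Sum
open import Data.Vec.Functional using (updateAt)
open import Data.Vec.Functional.Properties using (updateAt-updates; updateAt-minimal)
open import Function using (_∘_; _∘′_; const)
open import Function.Bundles using (_↔_; Inverse)
open import Function.Construct.Composition using (_↔-∘_)
open import Function.Construct.Identity using (↔-id)
open import Function.Definitions using (Injective)
open import Relation.Nullary using (yes; no)
open import Relation.Binary.PropositionalEquality using (_≡_; _≢_; refl; sym; trans; cong; subst; subst₂)

false≢true : false ≢ true
false≢true ()

pullback-isOriented : ∀ {V W : Set} {arc : W → W → Bool} →
  IsOriented arc → (f : V → W) → IsOriented (λ x y → arc (f x) (f y))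
pullback-isOriented oriented f = record
  { noLoop = noLoop oriented ∘ f
  ; noOpp  = λ x y → noOpp oriented (f x) (f y) }

upperOColorable-via : ∀ {V W : Set} {m : ℕ} {a : V → V → Bool} → Fin m ↔ W →
  (arc : W → W → Bool) → IsOriented arc →
  (∀ arcV → IsOrientation a arcV → Σ (V → W) (IsHom arcV arc)) →
  UpperOColorable a m
upperOColorable-via Fin↔W arc oriented colour =
  record { arcT = λ x y → arc (to x) (to y) ; isOrT = pullback-isOriented oriented to } ,
  λ arcV orientation →
    let (f , hom) = colour arcV orientation in
    from ∘ f ,
    λ x y e → subst₂ (λ p q → arc p q ≡ true)
                (sym (strictlyInverseˡ (f x))) (sym (strictlyInverseˡ (f y))) (hom x y e)
  where open Inverse Fin↔W

next : Fin 3 → Fin 3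
next zero             = suc zero
next (suc zero)       = suc (suc zero)
next (suc (suc zero)) = zero

-- layerArc c c' s s' x, where s, s' are the bits of the two ends and x the arc inside a
-- layer: between layers c and next c the arc points towards c iff the bit of the end in
-- next c is true.
layerArc : Fin 3 → Fin 3 → Bool → Bool → Bool → Bool
layerArc zero             zero             s s' x = x
layerArc zero             (suc zero)       s s' x = not s'
layerArc zero             (suc (suc zero)) s s' x = s
layerArc (suc zero)       zero             s s' x = s
layerArc (suc zero)       (suc zero)       s s' x = x
layerArc (suc zero)       (suc (suc zero)) s s' x = not s'
layerArc (suc (suc zero)) zero             s s' x = not s'
layerArc (suc (suc zero)) (suc zero)       s s' x = s
layerArc (suc (suc zero)) (suc (suc zero)) s s' x = x

layerArc-same : ∀ c s s' x → layerArc c c s s' x ≡ x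
layerArc-same zero             s s' x = refl
layerArc-same (suc zero)       s s' x = refl
layerArc-same (suc (suc zero)) s s' x = refl

layerArc-up : ∀ c' s' x → layerArc (next c') c' true s' x ≡ true
layerArc-up zero             s' x = refl
layerArc-up (suc zero)       s' x = refl
layerArc-up (suc (suc zero)) s' x = refl

layerArc-down : ∀ c s x → layerArc c (next c) s false x ≡ true
layerArc-down zero             s x = refl
layerArc-down (suc zero)       s x = refl
layerArc-down (suc (suc zero)) s x = refl

layerArc-antisym : ∀ c c' s s' x y → (x ≡ true → y ≡ false) →
  layerArc c c' s s' x ≡ true → layerArc c' c s' s y ≡ false
layerArc-antisym zero             zero             s     s'    x y xy e = xy e
layerArc-antisym zero             (suc zero)       s     false x y xy e = refl
layerArc-antisym zero             (suc (suc zero)) true  s'    x y xy e = refl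
layerArc-antisym (suc zero)       zero             true  s'    x y xy e = refl
layerArc-antisym (suc zero)       (suc zero)       s     s'    x y xy e = xy e
layerArc-antisym (suc zero)       (suc (suc zero)) s     false x y xy e = refl
layerArc-antisym (suc (suc zero)) zero             s     false x y xy e = refl
layerArc-antisym (suc (suc zero)) (suc zero)       true  s'    x y xy e = refl
layerArc-antisym (suc (suc zero)) (suc (suc zero)) s     s'    x y xy e = xy e

Layered : Set → Set
Layered A = (Fin 3 × Bool) × A

layered : ∀ {A : Set} → (A → A → Bool) → Layered A → Layered A → Bool
layered R ((c , s) , x) ((c' , s') , y) = layerArc c c' s s' (R x y)

layered-isOriented : ∀ {A : Set} {R : A → A → Bool} → IsOriented R → IsOriented (layered R)
layered-isOriented oriented = record
  { noLoop = λ { ((c , s) , x) → trans (layerArc-same c s s _) (noLoop oriented x) }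
  ; noOpp  = λ { ((c , s) , x) ((c' , s') , y) →
                   layerArc-antisym c c' s s' _ _ (noOpp oriented x y) } }

Fin↔Layered : ∀ k → Fin (6 * k) ↔ Layered (Fin k)
Fin↔Layered k = ((↔-id _ ×-↔ 2↔Bool) ×-↔ ↔-id _) ↔-∘ ((*↔× {3} {2} ×-↔ ↔-id _) ↔-∘ *↔× {6} {k})

module _ {m n : ℕ} (G : Graph m) (H : Graph n) where

  ∨-drop-loop : ∀ b v x → (b ∧ adj H v v) ∨ x ≡ x
  ∨-drop-loop b v x rewrite loopless H v | ∧-zeroʳ b = refl

  □-adj-within-copy : ∀ u u' v → □-adj G H (u , v) (u' , v) ≡ adj G u u'
  □-adj-within-copy u u' v with v ≟ v
  ... | yes refl = ∨-drop-loop _ v _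
  ... | no v≢v = ⊥-elim (v≢v refl)

  □-adj-cases : ∀ u v u' v' → □-adj G H (u , v) (u' , v') ≡ true →
                (v ≡ v' × adj G u u' ≡ true) ⊎ (u ≡ u' × adj H v v' ≡ true)
  □-adj-cases u v u' v' e with v ≟ v'
  ... | yes refl = inj₁ (refl , trans (sym (∨-drop-loop _ v _)) e)
  ... | no _ with u ≟ u'
  ...   | yes refl = inj₂ (refl , trans (sym (∨-identityʳ (adj H v v'))) e)
  ...   | no _     = ⊥-elim (false≢true e)

  copy-isOrientation : ∀ {arc} → IsOrientation (□-adj G H) arc →
    ∀ v → IsOrientation (adj G) (λ u u' → arc (u , v) (u' , v))
  copy-isOrientation orientation v = record
    { oriented = record { noLoop = λ u → noLoop (oriented orientation) (u , v)
                        ; noOpp  = λ u u' → noOpp (oriented orientation) (u , v) (u' , v) }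
    ; arc⇒edge = λ u u' e → trans (sym (□-adj-within-copy u u' v)) (arc⇒edge orientation _ _ e)
    ; edge⇒arc = λ u u' e → edge⇒arc orientation _ _ (trans (□-adj-within-copy u u' v) e) }

record Layering {n : ℕ} (H : Graph n) : Set where
  field
    parent : Fin n → Fin n
    layer  : Fin n → Fin 3
    edge-to-parent : ∀ v w → adj H v w ≡ true →
      (parent v ≡ w × layer v ≡ next (layer w)) ⊎ (parent w ≡ v × layer w ≡ next (layer v))

□-upperOColorable : ∀ {m n} (G : Graph m) (H : Graph n) → Layering H → ∀ k →
  UpperOColorable (adj G) k → UpperOColorable (□-adj G H) (6 * k)
□-upperOColorable {m} {n} G H L k (Tₖ , colourCopy) =
  upperOColorable-via (Fin↔Layered k) (layered (arcT Tₖ)) (layered-isOriented (isOrT Tₖ))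
    λ arc orientation → colour arc orientation , hom arc orientation
  where
  open Layering L

  colourIn : ∀ {arc} → IsOrientation (□-adj G H) arc → ∀ v →
             Σ (Fin m → Fin k) (IsHom (λ u u' → arc (u , v) (u' , v)) (arcT Tₖ))
  colourIn orientation v = colourCopy _ (copy-isOrientation G H orientation v)

  colour : ∀ arc → IsOrientation (□-adj G H) arc → Fin m × Fin n → Layered (Fin k)
  colour arc orientation (u , v) =
    (layer v , arc (u , v) (u , parent v)) , proj₁ (colourIn orientation v) u

  hom : ∀ arc orientation → IsHom arc (layered (arcT Tₖ)) (colour arc orientation)
  hom arc orientation (u , v) (u' , v') e with □-adj-cases G H u v u' v' (arc⇒edge orientation _ _ e)
  ... | inj₁ (refl , _) = trans (layerArc-same (layer v) _ _ _) (proj₂ (colourIn orientation v) u u' e)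
  ... | inj₂ (refl , vv') with edge-to-parent v v' vv'
  ...   | inj₁ (refl , layer-v) rewrite layer-v | e = layerArc-up (layer v') _ _
  ...   | inj₂ (refl , layer-v') rewrite layer-v' | noOpp (oriented orientation) _ _ e
        = layerArc-down (layer v) _ _

opposite-inject₁ : ∀ {n} (i : Fin (suc n)) → opposite (inject₁ i) ≡ suc (opposite i)
opposite-inject₁ zero            = refl
opposite-inject₁ {suc n} (suc i) = cong inject₁ (opposite-inject₁ i)

opposite-fromℕ : ∀ n → opposite (fromℕ n) ≡ zero
opposite-fromℕ zero    = refl
opposite-fromℕ (suc n) = cong inject₁ (opposite-fromℕ n)

module Paths {t : ℕ} (T : Graph t) where

  adj⇒≢ : ∀ {v w} → adj T v w ≡ true → v ≢ w
  adj⇒≢ {v} vw refl = false≢true (trans (sym (loopless T v)) vw)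

  -- Indexed like Cycle, so that a path together with a closing edge is a cycle.
  record Path (s w : Fin t) : Set where
    field
      len    : ℕ
      vertex : Fin (suc (suc (suc len))) → Fin t
      inj    : Injective _≡_ _≡_ vertex
      edge   : ∀ i → adj T (vertex (inject₁ i)) (vertex (suc i)) ≡ true
      first  : vertex zero ≡ s
      last   : vertex (fromℕ (suc (suc len))) ≡ w
  open Path

  Path⇒≢ : ∀ {s w} → Path s w → s ≢ w
  Path⇒≢ P refl with inj P (trans (first P) (sym (last P)))
  ... | ()

  acyclic⇒¬closing-edge : Acyclic T → ∀ {s w} → Path s w → adj T w s ≡ true → ⊥
  acyclic⇒¬closing-edge acyclic P ws = acyclic record
    { len = len P ; c = vertex P ; inj = inj P ; cons = edge P
    ; close = subst₂ (λ x y → adj T x y ≡ true) (sym (last P)) (sym (first P)) ws }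

  reverse : ∀ {s w} → Path s w → Path w s
  reverse P = record
    { len    = len P
    ; vertex = vertex P ∘ opposite
    ; inj    = λ {i} {j} e → trans (sym (opposite-involutive i))
                 (trans (cong opposite (inj P e)) (opposite-involutive j))
    ; edge   = λ i → subst (λ j → adj T (vertex P j) (vertex P (inject₁ (opposite i))) ≡ true)
                 (sym (opposite-inject₁ i)) (Graph.sym T _ _ (edge P (opposite i)))
    ; first  = last P
    ; last   = trans (cong (vertex P) (opposite-fromℕ _)) (first P) }

  triangle : ∀ {a b c} → a ≢ b → a ≢ c → b ≢ c →
             adj T a b ≡ true → adj T b c ≡ true → Path a c
  triangle {a} {b} {c} a≢b a≢c b≢c ab bc = record
    { len = 0 ; vertex = abc ; inj = abc-injective ; edge = abc-edge ; first = refl ; last = refl }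
    where
    abc : Fin 3 → Fin t
    abc zero             = a
    abc (suc zero)       = b
    abc (suc (suc zero)) = c

    abc-injective : Injective _≡_ _≡_ abc
    abc-injective {zero}           {zero}           _ = refl
    abc-injective {zero}           {suc zero}       e = ⊥-elim (a≢b e)
    abc-injective {zero}           {suc (suc zero)} e = ⊥-elim (a≢c e)
    abc-injective {suc zero}       {zero}           e = ⊥-elim (a≢b (sym e))
    abc-injective {suc zero}       {suc zero}       _ = refl
    abc-injective {suc zero}       {suc (suc zero)} e = ⊥-elim (b≢c e)
    abc-injective {suc (suc zero)} {zero}           e = ⊥-elim (a≢c (sym e))
    abc-injective {suc (suc zero)} {suc zero}       e = ⊥-elim (b≢c (sym e))
    abc-injective {suc (suc zero)} {suc (suc zero)} _ = refl

    abc-edge : ∀ i → adj T (abc (inject₁ i)) (abc (suc i)) ≡ true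
    abc-edge zero       = ab
    abc-edge (suc zero) = bc

  prepend : ∀ {x s w} (P : Path s w) → adj T x s ≡ true → (∀ i → x ≢ vertex P i) → Path x w
  prepend {x} {s} {w} P xs x∉P = record
    { len = suc (len P) ; vertex = x◅P ; inj = x◅P-injective ; edge = x◅P-edge
    ; first = refl ; last = last P }
    where
    x◅P : Fin (suc (suc (suc (suc (len P))))) → Fin t
    x◅P zero    = x
    x◅P (suc i) = vertex P i

    x◅P-injective : Injective _≡_ _≡_ x◅P
    x◅P-injective {zero}  {zero}  _ = refl
    x◅P-injective {zero}  {suc j} e = ⊥-elim (x∉P j e)
    x◅P-injective {suc i} {zero}  e = ⊥-elim (x∉P i (sym e))
    x◅P-injective {suc i} {suc j} e = cong suc (inj P e)

    x◅P-edge : ∀ i → adj T (x◅P (inject₁ i)) (x◅P (suc i)) ≡ true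
    x◅P-edge zero    = subst (λ y → adj T x y ≡ true) (sym (first P)) xs
    x◅P-edge (suc i) = edge P i

module Rooting {t : ℕ} (T : Graph t) (root : Fin t) where

  record RootedSubtree : Set where
    field
      inside      : Fin t → Bool
      parent      : Fin t → Fin t
      height      : Fin t → ℕ
      root-inside : inside root ≡ true
      parent-root : parent root ≡ root
      height-root : height root ≡ 0
      parent-edge : ∀ v → inside v ≡ true → v ≢ root →
        inside (parent v) ≡ true × adj T v (parent v) ≡ true × height v ≡ suc (height (parent v))
  open RootedSubtree

  _⊆_ : RootedSubtree → RootedSubtree → Set
  S ⊆ S' = ∀ v → inside S v ≡ true → inside S' v ≡ true

  ⊆-trans : ∀ {S₁ S₂ S₃} → S₁ ⊆ S₂ → S₂ ⊆ S₃ → S₁ ⊆ S₃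
  ⊆-trans S₁⊆S₂ S₂⊆S₃ v = S₂⊆S₃ v ∘′ S₁⊆S₂ v

  inside-outside-≢ : ∀ {S v x} → inside S v ≡ true → inside S x ≡ false → v ≢ x
  inside-outside-≢ v∈ x∉ refl = false≢true (trans (sym x∉) v∈)

  singleton : RootedSubtree
  singleton = record
    { inside      = updateAt (const false) root (const true)
    ; parent      = λ v → v
    ; height      = const 0
    ; root-inside = updateAt-updates root (const false)
    ; parent-root = refl
    ; height-root = refl
    ; parent-edge = λ v v∈ v≢root →
        ⊥-elim (false≢true (trans (sym (updateAt-minimal v root (const false) v≢root)) v∈)) }

  attach : (S : RootedSubtree) {s x : Fin t} → inside S s ≡ true → inside S x ≡ false →
           adj T s x ≡ true → Σ RootedSubtree λ S' → S ⊆ S' × inside S' x ≡ true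
  attach S {s} {x} s∈ x∉ sx = S' , grows , updateAt-updates x (inside S)
    where
    inside' : Fin t → Bool
    inside' = updateAt (inside S) x (const true)
    parent' : Fin t → Fin t
    parent' = updateAt (parent S) x (const s)
    height' : Fin t → ℕ
    height' = updateAt (height S) x (const (suc (height S s)))

    grows : ∀ v → inside S v ≡ true → inside' v ≡ true
    grows v v∈ with v ≟ x
    ... | yes refl = updateAt-updates x (inside S)
    ... | no v≢x   = trans (updateAt-minimal v x (inside S) v≢x) v∈

    parent-edge' : ∀ v → inside' v ≡ true → v ≢ root →
      inside' (parent' v) ≡ true × adj T v (parent' v) ≡ true × height' v ≡ suc (height' (parent' v))
    parent-edge' v v∈ v≢root with v ≟ x
    ... | yes refl
      rewrite updateAt-updates x {const s} (parent S)
            | updateAt-updates x {const (suc (height S s))} (height S)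
            | updateAt-minimal s x {const (suc (height S s))} (height S) (inside-outside-≢ {S} s∈ x∉)
      = grows s s∈ , Graph.sym T s x sx , refl
    ... | no v≢x with parent-edge S v (trans (sym (updateAt-minimal v x (inside S) v≢x)) v∈) v≢root
    ...   | p∈ , vp , hv
      rewrite updateAt-minimal v x {const s} (parent S) v≢x
            | updateAt-minimal v x {const (suc (height S s))} (height S) v≢x
            | updateAt-minimal (parent S v) x {const (suc (height S s))} (height S)
                (inside-outside-≢ {S} p∈ x∉)
      = grows _ p∈ , vp , hv

    root≢x : root ≢ x
    root≢x = inside-outside-≢ {S} (root-inside S) x∉

    S' : RootedSubtree
    S' = record
      { inside      = inside'
      ; parent      = parent'
      ; height      = height'
      ; root-inside = grows root (root-inside S)
      ; parent-root = trans (updateAt-minimal root x (parent S) root≢x) (parent-root S)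
      ; height-root = trans (updateAt-minimal root x (height S) root≢x) (height-root S)
      ; parent-edge = parent-edge' }

  reach : (S : RootedSubtree) {a b : Fin t} → inside S a ≡ true → Walk T a b →
          Σ RootedSubtree λ S' → S ⊆ S' × inside S' b ≡ true
  reach S a∈ here = S , (λ _ v∈ → v∈) , a∈
  reach S a∈ (step {v = v} av walk) with inside S v in v∈?
  ... | true  = reach S v∈? walk
  ... | false with attach S a∈ v∈? av
  ...   | S₁ , S⊆S₁ , v∈ with reach S₁ v∈ walk
  ...     | S₂ , S₁⊆S₂ , b∈ = S₂ , ⊆-trans {S} {S₁} {S₂} S⊆S₁ S₁⊆S₂ , b∈

  cover : Connected T → (S : RootedSubtree) (vs : List (Fin t)) →
          Σ RootedSubtree λ S' → S ⊆ S' × All (λ v → inside S' v ≡ true) vs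
  cover connected S []       = S , (λ _ v∈ → v∈) , []
  cover connected S (v ∷ vs) with reach S (root-inside S) (connected root v)
  ... | S₁ , S⊆S₁ , v∈ with cover connected S₁ vs
  ...   | S₂ , S₁⊆S₂ , vs∈ = S₂ , ⊆-trans {S} {S₁} {S₂} S⊆S₁ S₁⊆S₂ , S₁⊆S₂ v v∈ ∷ vs∈

  spanning : Connected T → Σ RootedSubtree λ S → ∀ v → inside S v ≡ true
  spanning connected with cover connected singleton (allFin t)
  ... | S , _ , all∈ = S , λ v → lookup all∈ (∈-allFin v)

module ParentEdges {t : ℕ} (T : Graph t) (acyclic : Acyclic T) {root : Fin t}
  (S : Rooting.RootedSubtree T root) (spans : ∀ v → Rooting.RootedSubtree.inside S v ≡ true) where
  open Paths T
  open Path
  open Rooting.RootedSubtree S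

  parent-step : ∀ {v} → v ≢ root → adj T v (parent v) ≡ true × height v ≡ suc (height (parent v))
  parent-step {v} v≢root = proj₂ (parent-edge v (spans v) v≢root)

  parent-lower : ∀ {v} → v ≢ root → height (parent v) < height v
  parent-lower v≢root = ≤-reflexive (sym (proj₂ (parent-step v≢root)))

  lower⇒≢ : ∀ {x y} → height x < height y → x ≢ y
  lower⇒≢ x<y refl = <-irrefl refl x<y

  height≡0⇒root : ∀ {v} → height v ≡ 0 → v ≡ root
  height≡0⇒root {v} h≡0 with v ≟ root
  ... | yes v≡root = v≡root
  ... | no v≢root  = ⊥-elim (n≮0 (subst (height (parent v) <_) h≡0 (parent-lower v≢root)))

  ≤-root⇒≡ : ∀ {s w} → height w ≤ height s → s ≡ root → s ≡ w
  ≤-root⇒≡ {w = w} hw≤hs refl = sym (height≡0⇒root (n≤0⇒n≡0 (subst (height w ≤_) height-root hw≤hs)))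

  High : ∀ {s w} → Path s w → Set
  High {s} {w} P = ∀ i → let x = vertex P i in
    x ≡ s ⊎ x ≡ w ⊎ (height s ≤ height x × height w ≤ height x)

  reverse-High : ∀ {s w} (P : Path s w) → High P → High (reverse P)
  reverse-High P high i with high (opposite i)
  ... | inj₁ x≡s              = inj₂ (inj₁ x≡s)
  ... | inj₂ (inj₁ x≡w)       = inj₁ x≡w
  ... | inj₂ (inj₂ (hs , hw)) = inj₂ (inj₂ (hw , hs))

  prepend-parent : ∀ {s w} (P : Path s w) → High P → s ≢ root → parent s ≢ w →
                   height w ≤ height s → Σ (Path (parent s) w) High
  prepend-parent {s} {w} P high s≢root ps≢w hw≤hs = prepend P ps-s ps∉P , high'
    where
    ps-s : adj T (parent s) s ≡ true
    ps-s = Graph.sym T _ _ (proj₁ (parent-step s≢root))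

    ps<s : height (parent s) < height s
    ps<s = parent-lower s≢root

    ps∉P : ∀ i → parent s ≢ vertex P i
    ps∉P i with high i
    ... | inj₁ x≡s             = λ e → lower⇒≢ ps<s (trans e x≡s)
    ... | inj₂ (inj₁ x≡w)      = λ e → ps≢w (trans e x≡w)
    ... | inj₂ (inj₂ (hs , _)) = lower⇒≢ (<-≤-trans ps<s hs)

    high' : High (prepend P ps-s ps∉P)
    high' zero = inj₁ refl
    high' (suc i) with high i
    ... | inj₁ x≡s = inj₂ (inj₂ (subst (λ y → height (parent s) ≤ height y) (sym x≡s) (<⇒≤ ps<s) ,
                                 subst (λ y → height w ≤ height y) (sym x≡s) hw≤hs))
    ... | inj₂ (inj₁ x≡w)       = inj₂ (inj₁ x≡w)
    ... | inj₂ (inj₂ (hs , hw)) = inj₂ (inj₂ (≤-trans (<⇒≤ ps<s) hs , hw))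

  -- Extend a high path at its higher end by the parent of that end; the heights of the
  -- ends decrease, so eventually that parent is the other end and the path closes into a
  -- cycle.
  mutual
    ¬High : ∀ n {s w} → height s + height w ≤ n → (P : Path s w) → High P → ⊥
    ¬High n {s} {w} bound P high with height w ≤? height s
    ... | yes hw≤hs = climb n bound hw≤hs P high
    ... | no  hw≰hs = climb n (subst (_≤ n) (+-comm (height s) (height w)) bound) (≰⇒≥ hw≰hs)
                              (reverse P) (reverse-High P high)

    climb : ∀ n {s w} → height s + height w ≤ n → height w ≤ height s →
            (P : Path s w) → High P → ⊥
    climb zero {s} bound hw≤hs P high =
      Path⇒≢ P (≤-root⇒≡ hw≤hs (height≡0⇒root (n≤0⇒n≡0 (m+n≤o⇒m≤o (height s) bound))))
    climb (suc n) {s} {w} bound hw≤hs P high with s ≟ root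
    ... | yes s≡root = Path⇒≢ P (≤-root⇒≡ hw≤hs s≡root)
    ... | no s≢root with parent s ≟ w
    ...   | yes refl = acyclic⇒¬closing-edge acyclic P (Graph.sym T _ _ (proj₁ (parent-step s≢root)))
    ...   | no ps≢w with prepend-parent P high s≢root ps≢w hw≤hs
    ...     | P' , high' = ¬High n bound' P' high'
      where
      bound' : height (parent s) + height w ≤ n
      bound' = s≤s⁻¹ (subst (λ h → h + height w ≤ suc n) (proj₂ (parent-step s≢root)) bound)

  ¬non-parent-edge : ∀ {v w} → adj T v w ≡ true → parent v ≢ w → height w ≤ height v → ⊥
  ¬non-parent-edge {v} {w} vw pv≢w hw≤hv with v ≟ root
  ... | yes v≡root = adj⇒≢ vw (≤-root⇒≡ hw≤hv v≡root)
  ... | no v≢root  = ¬High _ ≤-refl (triangle pv≢v pv≢w (adj⇒≢ vw) pv-v vw) high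
    where
    pv-v : adj T (parent v) v ≡ true
    pv-v = Graph.sym T _ _ (proj₁ (parent-step v≢root))

    pv≢v : parent v ≢ v
    pv≢v = lower⇒≢ (parent-lower v≢root)

    high : High (triangle pv≢v pv≢w (adj⇒≢ vw) pv-v vw)
    high zero             = inj₁ refl
    high (suc zero)       = inj₂ (inj₂ (<⇒≤ (parent-lower v≢root) , hw≤hv))
    high (suc (suc zero)) = inj₂ (inj₁ refl)

  every-edge-is-parent-edge : ∀ v w → adj T v w ≡ true →
    (parent v ≡ w × height v ≡ suc (height w)) ⊎ (parent w ≡ v × height w ≡ suc (height v))
  every-edge-is-parent-edge v w vw with parent v ≟ w | parent w ≟ v
  ... | yes refl | _ = inj₁ (refl , proj₂ (parent-step v≢root))
    where
    v≢root : v ≢ root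
    v≢root refl = adj⇒≢ vw (sym parent-root)
  ... | no _ | yes refl = inj₂ (refl , proj₂ (parent-step w≢root))
    where
    w≢root : w ≢ root
    w≢root refl = adj⇒≢ vw parent-root
  ... | no pv≢w | no pw≢v with height w ≤? height v
  ...   | yes hw≤hv = ⊥-elim (¬non-parent-edge vw pv≢w hw≤hv)
  ...   | no  hw≰hv = ⊥-elim (¬non-parent-edge (Graph.sym T _ _ vw) pw≢v (≰⇒≥ hw≰hv))

mod₃ : ℕ → Fin 3
mod₃ zero    = zero
mod₃ (suc n) = next (mod₃ n)

tree-layering : ∀ {t} (T : Graph t) → IsTree T → Layering T
tree-layering {zero}  T _ = record { parent = λ () ; layer = λ () ; edge-to-parent = λ () }
tree-layering {suc t} T (connected , acyclic) = record
  { parent         = parent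
  ; layer          = mod₃ ∘ height
  ; edge-to-parent = λ v w vw →
      Sum.map (map₂ (cong mod₃)) (map₂ (cong mod₃)) (every-edge-is-parent-edge v w vw) }
  where
  open Rooting T zero
  S : RootedSubtree
  S = proj₁ (spanning connected)
  spans : ∀ v → RootedSubtree.inside S v ≡ true
  spans = proj₂ (spanning connected)
  open RootedSubtree S
  open ParentEdges T acyclic S spans

corollary5 : ∀ {t} (T : Graph t) → IsTree T →
    ∀ {n} (G : Graph n) (k : ℕ) →
      UpperOColorable (adj G) k → UpperOColorable (□-adj G T) (6 * k)
corollary5 T tree G = □-upperOColorable G T (tree-layering T tree)
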